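{- If $n=2k+1\ge 3$ is odd, then $\phi(F_n)\le (n+1)/2$.
   Context: For $u\in\{0,1\}^n$, $\overline{u}=u+(1,\dots,1)\pmod 2$. The folded hypercube $F_n$ has vertex set $\{\{u,\overline{u}\}:u\in\{0,1\}^n\}$, with $\{u,\overline u\}$ adjacent to $\{v,\overline v\}$ iff $u$ and $v$, or $u$ and $\overline v$, differ in exactly one coordinate; its distance is $\min\{h,n-h\}$ where $h$ is the Hamming distance of $u,v$. In a graph $G$, a pair $\{x,y\}$ doubly resolves $\{u,v\}$ if $d_G(u,x)-d_G(u,y)\neq d_G(v,x)-d_G(v,y)$. For a vertex $x$, $T\subseteq V(G)$ is a doubly distance resolving set of $G$ on $x$ if every pair $\{u,v\}$ with $d_G(u,x)\neq d_G(v,x)$ is doubly resolved by some pair of vertices of $T\cup\{x\}$; $\phi(G,x)$ is the minimum size of such a set, and $\phi(G)=\max\{\phi(G,x):x\in V(G)\}$. -}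

module Defs where

open import Data.Bool using (Bool; true; false; not; _xor_)
open import Data.Nat using (ℕ; zero; suc; _+_; _∸_; _⊓_; _≤_)
open import Data.Integer using (ℤ; +_; _-_)
open import Data.Vec using (Vec; []; _∷_; map)
open import Data.List using (List; _∷_; length)
open import Data.List.Membership.Propositional using (_∈_)
open import Data.Product using (Σ; ∃; _×_; _,_)
open import Relation.Binary.PropositionalEquality using (_≡_; _≢_)

Word : ℕ → Set
Word n = Vec Bool n

compl : ∀ {n} → Word n → Word n
compl = map not

hamming : ∀ {n} → Word n → Word n → ℕ
hamming [] [] = 0
hamming (a ∷ u) (b ∷ v) with a xor b
... | true  = suc (hamming u v)
... | false = hamming u v

-- A vertex {u, ū} of the folded hypercube F_n is represented by either of
-- its two representatives u ∈ {0,1}^n.  The distance of F_n between the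
-- vertices {u,ū} and {v,v̄} is min{h, n - h}, h the Hamming distance of u,v
-- (this value does not depend on the chosen representatives).
distF : (n : ℕ) → Word n → Word n → ℕ
distF n u v = hamming u v ⊓ (n ∸ hamming u v)

DoublyResolves : (n : ℕ) → (a b u v : Word n) → Set
DoublyResolves n a b u v =
  (+ distF n u a) - (+ distF n u b) ≢ (+ distF n v a) - (+ distF n v b)

IsDDRS : (n : ℕ) → (x : Word n) → List (Word n) → Set
IsDDRS n x T =
  ∀ (u v : Word n) → distF n u x ≢ distF n v x →
    Σ (Word n) λ a → Σ (Word n) λ b →
      (a ∈ (x ∷ T)) × (b ∈ (x ∷ T)) × DoublyResolves n a b u v

-- φ(F_n) ≤ m, i.e. max_x min{|T| : T a DDRS of F_n on x} ≤ m, unfolded: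
-- for every vertex x there is a DDRS on x with at most m vertices.
-- (A list of length ≤ m represents a vertex set of size ≤ m.)
PhiFLe : (n m : ℕ) → Set
PhiFLe n m = ∀ (x : Word n) → Σ (List (Word n)) λ T → (length T ≤ m) × IsDDRS n x T

-- Translating by x (an automorphism of F_n) moves x to the zero word, and since
-- n = 2k + 1 is odd every vertex has a unique representative u of weight w ≤ k,
-- so d(u, 0) = w.  Cut the coordinates into k pairs and one singleton, and take
-- these blocks t (translated back by x) as the resolving set.  If u has c ones in
-- a block of size s, then hamming(u, t) = w + s − 2c, and the excess
-- d(u, t) − d(u, 0) is s − 2c unless that Hamming distance exceeds k; this can
-- only happen for c = 0, where the excess is 2(k − w) + 1 − s.  In either case the
-- excess determines c, so two vertices that no pair {x ⊕ t, x} doubly resolves have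
-- equally many ones in every block, hence equal weight and equal distance to x.

module Submission where

open import Defs
open import Data.Bool using (true; false; _xor_)
open import Data.Bool.Properties using (xor-assoc; xor-identityʳ)
open import Data.Nat using (ℕ; zero; suc; _+_; _*_; _∸_; _⊓_; _≤_; _<_; z≤n; s≤s; _≤?_)
open import Data.Nat.Properties
  using ( +-suc; +-comm; +-assoc; +-cancelˡ-≡; +-cancelʳ-≤; +-cancelˡ-<
        ; +-mono-≤; +-monoʳ-≤; +-monoˡ-<; +-mono-≤-<; m+n∸m≡n; m+n∸n≡m; m+n≤o⇒m≤o∸n
        ; ≤-reflexive; ≤-trans; <-≤-trans; <⇒≤; <⇒≱; ≰⇒>; n≤1+n; m≤n⇒m≤1+n; m≤n⇒∃[o]m+o≡n
        ; ⊓-comm; m≤n⇒m⊓n≡m; m≥n⇒m⊓n≡n; module ≤-Reasoning )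
open import Data.Nat.ListAction using (sum)
open import Data.Nat.Tactic.RingSolver using (solve-∀)
open import Data.Integer using (ℤ; +_; -[1+_]; _⊖_; _-_; _≟_)
open import Data.Integer.Properties using (+-cancelˡ-⊖; [+m]-[+n]≡m⊖n)
open import Data.Vec using (_∷_; []; replicate; zipWith)
open import Data.Vec.Properties using (zipWith-assoc; zipWith-identityʳ)
open import Data.List using (List; []; _∷_; map; length)
open import Data.List.Properties using (length-map; map-∘; map-cong-local)
open import Data.List.Membership.Propositional using (_∈_; find)
open import Data.List.Membership.Propositional.Properties using (∈-map⁺)
open import Data.List.Relation.Unary.Any using (here; there)
open import Data.List.Relation.Unary.All as All using (All; all?; []; _∷_)
open import Data.List.Relation.Unary.All.Properties using (¬All⇒Any¬; map⁺)
open import Data.Product using (_×_; _,_; proj₁; proj₂)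
open import Function using (_∘_)
open import Data.Sum using (_⊎_; inj₁; inj₂)
open import Relation.Nullary using (yes; no; contradiction)
open import Relation.Binary.PropositionalEquality

zeros : ∀ {n} → Word n
zeros = replicate _ false

infixl 6 _⊕_
_⊕_ : ∀ {n} → Word n → Word n → Word n
_⊕_ = zipWith _xor_

weight : ∀ {n} → Word n → ℕ
weight u = hamming u zeros

common : ∀ {n} → Word n → Word n → ℕ
common []       []           = 0
common (a ∷ u)     (false ∷ t) = common u t
common (false ∷ u) (true ∷ t)  = common u t
common (true ∷ u)  (true ∷ t)  = suc (common u t)

hamming≡weight-⊕ : ∀ {n} (u v : Word n) → hamming u v ≡ weight (u ⊕ v)
hamming≡weight-⊕ []      []      = refl
hamming≡weight-⊕ (a ∷ u) (b ∷ v) with a xor b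
... | true  = cong suc (hamming≡weight-⊕ u v)
... | false = hamming≡weight-⊕ u v

hamming-⊕ : ∀ {n} (u x t : Word n) → hamming u (x ⊕ t) ≡ hamming (u ⊕ x) t
hamming-⊕ u x t = begin
  hamming u (x ⊕ t)   ≡⟨ hamming≡weight-⊕ u (x ⊕ t) ⟩
  weight (u ⊕ (x ⊕ t)) ≡⟨ cong weight (zipWith-assoc xor-assoc u x t) ⟨
  weight (u ⊕ x ⊕ t)   ≡⟨ hamming≡weight-⊕ (u ⊕ x) t ⟨
  hamming (u ⊕ x) t   ∎
  where open ≡-Reasoning

⊕-zeros : ∀ {n} (x : Word n) → x ⊕ zeros ≡ x
⊕-zeros = zipWith-identityʳ xor-identityʳ

hamming-compl : ∀ {n} (u t : Word n) → hamming u t + hamming (compl u) t ≡ n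
hamming-compl []         []         = refl
hamming-compl (true ∷ u)  (true ∷ t)  = trans (+-suc _ _) (cong suc (hamming-compl u t))
hamming-compl (true ∷ u)  (false ∷ t) = cong suc (hamming-compl u t)
hamming-compl (false ∷ u) (true ∷ t)  = cong suc (hamming-compl u t)
hamming-compl (false ∷ u) (false ∷ t) = trans (+-suc _ _) (cong suc (hamming-compl u t))

hamming+common : ∀ {n} (u t : Word n) →
                 hamming u t + (common u t + common u t) ≡ weight u + weight t
hamming+common []          []          = refl
hamming+common (true ∷ u)  (true ∷ t)  = begin
  hamming u t + (suc c + suc c)      ≡⟨ shuffle (hamming u t) c ⟩
  suc (suc (hamming u t + (c + c)))  ≡⟨ cong (suc ∘ suc) (hamming+common u t) ⟩
  suc (suc (weight u + weight t))    ≡⟨ cong suc (+-suc (weight u) (weight t)) ⟨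
  suc (weight u + suc (weight t))    ∎
  where
  open ≡-Reasoning
  c = common u t
  shuffle : ∀ h c → h + (suc c + suc c) ≡ suc (suc (h + (c + c)))
  shuffle = solve-∀
hamming+common (true ∷ u)  (false ∷ t) = cong suc (hamming+common u t)
hamming+common (false ∷ u) (true ∷ t)  =
  trans (cong suc (hamming+common u t)) (sym (+-suc (weight u) (weight t)))
hamming+common (false ∷ u) (false ∷ t) = hamming+common u t

common≤weight : ∀ {n} (u t : Word n) → common u t ≤ weight t
common≤weight []          []          = z≤n
common≤weight (a ∷ u)     (false ∷ t) = common≤weight u t
common≤weight (false ∷ u) (true ∷ t)  = m≤n⇒m≤1+n (common≤weight u t)
common≤weight (true ∷ u)  (true ∷ t)  = s≤s (common≤weight u t)

module _ {n : ℕ} (u t : Word n) where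

  ∸-hamming : n ∸ hamming u t ≡ hamming (compl u) t
  ∸-hamming = trans (cong (_∸ hamming u t) (sym (hamming-compl u t))) (m+n∸m≡n (hamming u t) _)

  ∸-hamming-compl : n ∸ hamming (compl u) t ≡ hamming u t
  ∸-hamming-compl = trans (cong (_∸ hamming (compl u) t) (sym (hamming-compl u t))) (m+n∸n≡m _ (hamming (compl u) t))

  distF≡hamming⊓hamming-compl : distF n u t ≡ hamming u t ⊓ hamming (compl u) t
  distF≡hamming⊓hamming-compl = cong (hamming u t ⊓_) ∸-hamming

  distF-compl : distF n (compl u) t ≡ distF n u t
  distF-compl = begin
    hamming (compl u) t ⊓ (n ∸ hamming (compl u) t) ≡⟨ cong (hamming (compl u) t ⊓_) ∸-hamming-compl ⟩
    hamming (compl u) t ⊓ hamming u t               ≡⟨ ⊓-comm _ _ ⟩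
    hamming u t ⊓ hamming (compl u) t               ≡⟨ distF≡hamming⊓hamming-compl ⟨
    distF n u t                                     ∎
    where open ≡-Reasoning

distF-⊕ : ∀ n (u x t : Word n) → distF n u (x ⊕ t) ≡ distF n (u ⊕ x) t
distF-⊕ n u x t = cong (λ h → h ⊓ (n ∸ h)) (hamming-⊕ u x t)

light : ∀ k → Word (suc (k + k)) → Word (suc (k + k))
light k u with weight u ≤? k
... | yes _ = u
... | no  _ = compl u

weight-light : ∀ k u → weight (light k u) ≤ k
weight-light k u with weight u ≤? k
... | yes w≤k = w≤k
... | no  w≰k = +-cancelʳ-≤ (suc k) (weight (compl u)) k (begin
  weight (compl u) + suc k      ≤⟨ +-monoʳ-≤ (weight (compl u)) (≰⇒> w≰k) ⟩
  weight (compl u) + weight u   ≡⟨ +-comm _ (weight u) ⟩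
  weight u + weight (compl u)   ≡⟨ hamming-compl u zeros ⟩
  suc (k + k)                   ≡⟨ +-suc k k ⟨
  k + suc k                     ∎)
  where open ≤-Reasoning

distF-light : ∀ k u t → distF (suc (k + k)) (light k u) t ≡ distF (suc (k + k)) u t
distF-light k u t with weight u ≤? k
... | yes _ = refl
... | no  _ = distF-compl u t

distF-zeros : ∀ k (u : Word (suc (k + k))) → weight u ≤ k → distF (suc (k + k)) u zeros ≡ weight u
distF-zeros k u w≤k = m≤n⇒m⊓n≡m (m+n≤o⇒m≤o∸n (weight u) (m≤n⇒m≤1+n (+-mono-≤ w≤k w≤k)))

⊖-cross : ∀ a b c d → a + d ≡ b + c → a ⊖ b ≡ c ⊖ d
⊖-cross a b c d eq = begin
  a ⊖ b             ≡⟨ +-cancelˡ-⊖ d a b ⟨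
  (d + a) ⊖ (d + b) ≡⟨ cong₂ _⊖_ (trans (+-comm d a) eq) (+-comm d b) ⟩
  (b + c) ⊖ (b + d) ≡⟨ +-cancelˡ-⊖ b c d ⟩
  c ⊖ d             ∎
  where open ≡-Reasoning

decodeCommon : ℕ → ℤ → ℕ
decodeCommon 1 -[1+ _ ] = 1
decodeCommon 2 -[1+ 1 ] = 2
decodeCommon 2 (+ 0)    = 1
decodeCommon _ _        = 0

decodeCommon-unfolded : ∀ {s c} → s ≡ 1 ⊎ s ≡ 2 → c ≤ s → decodeCommon s (s ⊖ (c + c)) ≡ c
decodeCommon-unfolded (inj₁ refl) z≤n             = refl
decodeCommon-unfolded (inj₁ refl) (s≤s z≤n)       = refl
decodeCommon-unfolded (inj₂ refl) z≤n             = refl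
decodeCommon-unfolded (inj₂ refl) (s≤s z≤n)       = refl
decodeCommon-unfolded (inj₂ refl) (s≤s (s≤s z≤n)) = refl

decodeCommon-folded : ∀ {s c r} → s ≡ 1 ⊎ s ≡ 2 → c ≤ s → c + c + r < s →
                      decodeCommon s ((c + c + suc (r + r)) ⊖ s) ≡ c
decodeCommon-folded (inj₁ refl) z≤n             (s≤s z≤n)       = refl
decodeCommon-folded (inj₁ refl) (s≤s z≤n)       (s≤s ())
decodeCommon-folded (inj₂ refl) z≤n             (s≤s z≤n)       = refl
decodeCommon-folded (inj₂ refl) z≤n             (s≤s (s≤s z≤n)) = refl
decodeCommon-folded (inj₂ refl) (s≤s z≤n)       (s≤s (s≤s ()))
decodeCommon-folded (inj₂ refl) (s≤s (s≤s z≤n)) (s≤s (s≤s ()))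

larger-half : ∀ {k h h'} → h' < h → h + h' ≡ suc (k + k) → k < h
larger-half {k} {h} {h'} h'<h hh' = ≰⇒> λ h≤k →
  <⇒≱ (+-mono-≤-< h≤k (<-≤-trans h'<h h≤k)) (≤-trans (n≤1+n (k + k)) (≤-reflexive (sym hh')))

folded-excess : ∀ {w r s c h h'} → h' < h → h + (c + c) ≡ w + s → h + h' ≡ suc (w + r + (w + r)) →
                c + c + r < s × h' + s ≡ w + (c + c + suc (r + r))
folded-excess {w} {r} {s} {c} {h} {h'} h'<h hc hh' = bound , cross-sum
  where
  bound : c + c + r < s
  bound = +-cancelˡ-< w (c + c + r) s
    (subst₂ _<_ (regroup w r (c + c)) hc (+-monoˡ-< (c + c) (larger-half {w + r} h'<h hh')))
    where
    regroup : ∀ w r c₂ → w + r + c₂ ≡ w + (c₂ + r)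
    regroup = solve-∀

  cross-sum : h' + s ≡ w + (c + c + suc (r + r))
  cross-sum = +-cancelˡ-≡ h _ _ (begin
    h + (h' + s)                      ≡⟨ +-assoc h h' s ⟨
    h + h' + s                        ≡⟨ cong (_+ s) hh' ⟩
    suc (w + r + (w + r)) + s         ≡⟨ split w r s ⟩
    w + s + (w + suc (r + r))         ≡⟨ cong (_+ (w + suc (r + r))) hc ⟨
    h + (c + c) + (w + suc (r + r))   ≡⟨ regroup h (c + c) w (suc (r + r)) ⟩
    h + (w + (c + c + suc (r + r)))   ∎)
    where
    open ≡-Reasoning
    split : ∀ w r s → suc (w + r + (w + r)) + s ≡ w + s + (w + suc (r + r))
    split = solve-∀
    regroup : ∀ h c₂ w q → h + c₂ + (w + q) ≡ h + (w + (c₂ + q))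
    regroup = solve-∀

common-from-excess : ∀ {k w s c h h'} → s ≡ 1 ⊎ s ≡ 2 → w ≤ k → c ≤ s →
                     h + (c + c) ≡ w + s → h + h' ≡ suc (k + k) →
                     decodeCommon s ((h ⊓ h') ⊖ w) ≡ c
common-from-excess {w = w} {s} {c} {h} {h'} s∈ w≤k c≤s hc hh'
  with h ≤? h' | m≤n⇒∃[o]m+o≡n w≤k
... | yes h≤h' | _ = begin
  decodeCommon s ((h ⊓ h') ⊖ w)  ≡⟨ cong (λ d → decodeCommon s (d ⊖ w)) (m≤n⇒m⊓n≡m h≤h') ⟩
  decodeCommon s (h ⊖ w)         ≡⟨ cong (decodeCommon s) (⊖-cross h w s (c + c) hc) ⟩
  decodeCommon s (s ⊖ (c + c))   ≡⟨ decodeCommon-unfolded s∈ c≤s ⟩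
  c                              ∎
  where open ≡-Reasoning
... | no h≰h' | r , refl = begin
  decodeCommon s ((h ⊓ h') ⊖ w)  ≡⟨ cong (λ d → decodeCommon s (d ⊖ w)) (m≥n⇒m⊓n≡n (<⇒≤ h'<h)) ⟩
  decodeCommon s (h' ⊖ w)        ≡⟨ cong (decodeCommon s) (⊖-cross h' w q s cross-sum) ⟩
  decodeCommon s (q ⊖ s)         ≡⟨ decodeCommon-folded s∈ c≤s bound ⟩
  c                              ∎
  where
  open ≡-Reasoning
  q = c + c + suc (r + r)
  h'<h = ≰⇒> h≰h'
  folded = folded-excess {w} {r} {s} {c} {h} {h'} h'<h hc hh'
  bound = proj₁ folded
  cross-sum = proj₂ folded

common-from-distances : ∀ k (u t : Word (suc (k + k))) → weight u ≤ k → weight t ≡ 1 ⊎ weight t ≡ 2 →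
                        decodeCommon (weight t) (distF (suc (k + k)) u t ⊖ weight u) ≡ common u t
common-from-distances k u t w≤k size =
  subst (λ d → decodeCommon (weight t) (d ⊖ weight u) ≡ common u t)
        (sym (distF≡hamming⊓hamming-compl u t))
        (common-from-excess size w≤k (common≤weight u t) (hamming+common u t) (hamming-compl u t))

blocks : (m : ℕ) → List (Word m)
blocks zero          = []
blocks (suc zero)    = (true ∷ []) ∷ []
blocks (suc (suc m)) = (true ∷ true ∷ zeros) ∷ map (λ t → false ∷ false ∷ t) (blocks m)

length-blocks : ∀ k → length (blocks (suc (k + k))) ≡ suc k
length-blocks zero = refl
length-blocks (suc k) rewrite +-suc k k =
  cong suc (trans (length-map _ (blocks (suc (k + k)))) (length-blocks k))

weight-zeros : ∀ m → weight (zeros {m}) ≡ 0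
weight-zeros zero    = refl
weight-zeros (suc m) = weight-zeros m

weight-blocks : ∀ m → All (λ t → weight t ≡ 1 ⊎ weight t ≡ 2) (blocks m)
weight-blocks zero          = []
weight-blocks (suc zero)    = inj₁ refl ∷ []
weight-blocks (suc (suc m)) = inj₂ (cong (suc ∘ suc) (weight-zeros m)) ∷ map⁺ (weight-blocks m)

common-zeros : ∀ {m} (u : Word m) → common u zeros ≡ 0
common-zeros []      = refl
common-zeros (a ∷ u) = common-zeros u

weight-∷∷ : ∀ {m} a b (u : Word m) → weight (a ∷ b ∷ u) ≡ common (a ∷ b ∷ u) (true ∷ true ∷ zeros) + weight u
weight-∷∷ true  true  u rewrite common-zeros u = refl
weight-∷∷ true  false u rewrite common-zeros u = refl
weight-∷∷ false true  u rewrite common-zeros u = refl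
weight-∷∷ false false u rewrite common-zeros u = refl

weight≡sum-common : ∀ m (u : Word m) → weight u ≡ sum (map (common u) (blocks m))
weight≡sum-common zero          []           = refl
weight≡sum-common (suc zero)    (true ∷ [])  = refl
weight≡sum-common (suc zero)    (false ∷ []) = refl
weight≡sum-common (suc (suc m)) (a ∷ b ∷ u)  = begin
  weight (a ∷ b ∷ u)                            ≡⟨ weight-∷∷ a b u ⟩
  head + weight u                               ≡⟨ cong (λ w → head + w) (weight≡sum-common m u) ⟩
  head + sum (map (common u) (blocks m))        ≡⟨ cong (λ cs → head + sum cs) (map-∘ (blocks m)) ⟩
  sum (map (common (a ∷ b ∷ u)) (blocks (suc (suc m)))) ∎
  where
  open ≡-Reasoning
  head = common (a ∷ b ∷ u) (true ∷ true ∷ zeros)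

excess : ∀ n → (x u t : Word n) → ℤ
excess n x u t = + distF n u (x ⊕ t) - + distF n u x

module _ (k : ℕ) (x : Word (suc (k + k))) where

  private
    n = suc (k + k)

  distF-center : ∀ u → distF n u x ≡ weight (light k (u ⊕ x))
  distF-center u = begin
    distF n u x                      ≡⟨ cong (distF n u) (⊕-zeros x) ⟨
    distF n u (x ⊕ zeros)            ≡⟨ distF-⊕ n u x zeros ⟩
    distF n (u ⊕ x) zeros            ≡⟨ distF-light k (u ⊕ x) zeros ⟨
    distF n (light k (u ⊕ x)) zeros  ≡⟨ distF-zeros k (light k (u ⊕ x)) (weight-light k (u ⊕ x)) ⟩
    weight (light k (u ⊕ x))         ∎
    where open ≡-Reasoning

  excess-light : ∀ u t → excess n x u t ≡ distF n (light k (u ⊕ x)) t ⊖ weight (light k (u ⊕ x))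
  excess-light u t = trans ([+m]-[+n]≡m⊖n (distF n u (x ⊕ t)) (distF n u x))
    (cong₂ _⊖_ (trans (distF-⊕ n u x t) (sym (distF-light k (u ⊕ x) t))) (distF-center u))

  equal-excess⇒equal-distF : ∀ u v → All (λ t → excess n x u t ≡ excess n x v t) (blocks n) →
                             distF n u x ≡ distF n v x
  equal-excess⇒equal-distF u v equal = begin
    distF n u x                       ≡⟨ distF-center u ⟩
    weight u'                         ≡⟨ weight≡sum-common n u' ⟩
    sum (map (common u') (blocks n))  ≡⟨ cong sum (map-cong-local (All.tabulate common-agrees)) ⟩
    sum (map (common v') (blocks n))  ≡⟨ weight≡sum-common n v' ⟨
    weight v'                         ≡⟨ distF-center v ⟨
    distF n v x                       ∎
    where
    open ≡-Reasoning
    u' = light k (u ⊕ x)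
    v' = light k (v ⊕ x)

    common-agrees : ∀ {t} → t ∈ blocks n → common u' t ≡ common v' t
    common-agrees {t} t∈ = begin
      common u' t                                        ≡⟨ common-from-distances k u' t (weight-light k (u ⊕ x)) size ⟨
      decodeCommon (weight t) (distF n u' t ⊖ weight u')  ≡⟨ cong (decodeCommon (weight t)) (excess-light u t) ⟨
      decodeCommon (weight t) (excess n x u t)            ≡⟨ cong (decodeCommon (weight t)) (All.lookup equal t∈) ⟩
      decodeCommon (weight t) (excess n x v t)            ≡⟨ cong (decodeCommon (weight t)) (excess-light v t) ⟩
      decodeCommon (weight t) (distF n v' t ⊖ weight v')  ≡⟨ common-from-distances k v' t (weight-light k (v ⊕ x)) size ⟩
      common v' t                                        ∎
      where size = All.lookup (weight-blocks n) t∈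

  translated-blocks-resolve : IsDDRS n x (map (x ⊕_) (blocks n))
  translated-blocks-resolve u v d≢ with all? (λ t → excess n x u t ≟ excess n x v t) (blocks n)
  ... | yes equal = contradiction (equal-excess⇒equal-distF u v equal) d≢
  ... | no ¬equal with find (¬All⇒Any¬ (λ t → excess n x u t ≟ excess n x v t) _ ¬equal)
  ...   | t , t∈ , resolved = x ⊕ t , x , there (∈-map⁺ (x ⊕_) t∈) , here refl , resolved

phi-odd-folded-hypercube : ∀ k → PhiFLe (suc (k + k)) (k + 1)
phi-odd-folded-hypercube k x =
  map (x ⊕_) (blocks n) , ≤-reflexive size , translated-blocks-resolve k x
  where
  n = suc (k + k)
  size : length (map (x ⊕_) (blocks n)) ≡ k + 1
  size = trans (length-map _ (blocks n)) (trans (length-blocks k) (+-comm 1 k))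

-- The bound also holds for k = 0.
lemma8 : ∀ (k : ℕ) → 1 ≤ k → PhiFLe (2 * k + 1) (k + 1)
lemma8 k _ = subst (λ n → PhiFLe n (k + 1)) (sym (odd k)) (phi-odd-folded-hypercube k)
  where
  odd : ∀ k → 2 * k + 1 ≡ suc (k + k)
  odd = solve-∀
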